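{- Let $g:\mathbb{N}_{\ge1}\to\mathbb{N}$ be defined by $g(1) = 0, g(2) = 1, g(3) = 2, g(4) = 4, g(5) = 5$ and, for $n \geq 6$, $$g(n) = n - 1 + \min\{g(n_1) + g(n_2) : n_1, n_2 \text{ positive integers with } n_1 + n_2 = n - 1\}.$$ Then $g(n) = x_n$ for every integer $n \geq 1$.
   Context: The sequence $(x_n)_{n\ge1}$ is defined by $x_1 = 0, x_2 = 1, x_3 = 2, x_4 = 4, x_5 = 5$ and, for $n \geq 6$, $$x_n = (n - 1) + \begin{cases} x_{\frac{n + 1}{2}} + x_{\frac{n - 3}{2}}, & n \equiv 1 \pmod 4,\\ 2 x_{\frac{n - 1}{2}}, & n \equiv 3 \pmod 4,\\ x_{\frac{n}{2}} + x_{\frac{n - 2}{2}}, & n \text{ even}. \end{cases}$$ (In the paper, $g(n)$ is the number of arcs of a recursively constructed oriented graph $\overrightarrow{O}_n$ of weak diameter at most $2$: for $n\ge6$, $\overrightarrow{O}_n$ consists of disjoint copies of $\overrightarrow{O}_{n_1}$ and $\overrightarrow{O}_{n_2}$ with $n_1+n_2=n-1$ chosen to minimize the total arc count, plus a new vertex $v$ with arcs from every vertex of $\overrightarrow{O}_{n_1}$ to $v$ and from $v$ to every vertex of $\overrightarrow{O}_{n_2}$.) -}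

module Defs where

open import Data.Nat using (ℕ; zero; suc; _+_; _∸_; _⊓_; _<_; _≤_; s≤s; z≤n)
open import Data.Nat.Properties using (≤-refl; m≤n⇒m≤1+n; m≤m+n; ≤-trans; n≤1+n)
open import Data.Nat.Induction using (<-rec)

-- Sequences are represented as functions ℕ → ℕ; only arguments n ≥ 1 are
-- meaningful (the value at 0 is an arbitrary junk value 0).

minFrom1 : (ℕ → ℕ) → ℕ → ℕ
minFrom1 f zero    = f 1
minFrom1 f (suc m) = f (suc (suc m)) ⊓ minFrom1 f m

-- For n = 6 + k:  n - 1 = 5 + k, and n₁ ranges over 1 .. 4 + k, n₂ = (5 + k) ∸ n₁.
-- Recursive calls are guarded: for 1 ≤ n₁ ≤ 4 + k we have n₁ < 6 + k and n₂ < 6 + k;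
-- arguments not below n are never reached, we return 0 there (junk).

open import Relation.Nullary using (yes; no)
open import Data.Nat using (_<?_)

guard : (n : ℕ) → ({m : ℕ} → m < n → ℕ) → ℕ → ℕ
guard n rec m with m <? n
... | yes p = rec p
... | no _  = 0

gStep : (n : ℕ) → ({m : ℕ} → m < n → ℕ) → ℕ
gStep 0 _ = 0
gStep 1 _ = 0
gStep 2 _ = 1
gStep 3 _ = 2
gStep 4 _ = 4
gStep 5 _ = 5
gStep (suc (suc (suc (suc (suc (suc k)))))) rec =
  (5 + k) + minFrom1 (λ n₁ → G n₁ + G ((5 + k) ∸ n₁)) (3 + k)
  where G = guard (6 + k) rec

g : ℕ → ℕ
g = <-rec (λ _ → ℕ) gStep

xStep : (n : ℕ) → ({m : ℕ} → m < n → ℕ) → ℕ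
xStep 0 _ = 0
xStep 1 _ = 0
xStep 2 _ = 1
xStep 3 _ = 2
xStep 4 _ = 4
xStep 5 _ = 5
xStep n@(suc (suc (suc (suc (suc (suc k)))))) rec = (n ∸ 1) + body
  where
  X = guard n rec
  open import Data.Nat using (_%_; _/_)
  body : ℕ
  body with n % 4
  ... | 1 = X ((n + 1) / 2) + X ((n ∸ 3) / 2)
  ... | 3 = 2 Data.Nat.* X ((n ∸ 1) / 2)
  ... | _ = X (n / 2) + X ((n ∸ 2) / 2)

x : ℕ → ℕ
x = <-rec (λ _ → ℕ) xStep

-- The recurrence for x always splits n - 1 as hi n + lo n, so g = x amounts to this split
-- minimising x n₁ + x n₂, i.e. to the join inequality x (a + b + 1) ≤ (a + b) + x a + x b. For a, b ≥ 2 with splits (a₁, a₂) and (b₁, b₂), the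
-- split of a + b + 1 is (1 + a₁ + b₁, 1 + a₂ + b₂) up to the order of each pair, so the
-- inequalities for (a₁, b₁) and (a₂, b₂) add up to the one for (a, b). For a ≤ 1 one compares
-- the split of b + 1 or b + 2 with that of b, which differ in a single part. The only value
-- not given by its split is x 5 = 5, one less than 4 + x 3 + x 1; that case borrows the unit
-- from the stronger bound x (b + 2) ≤ b + x b for b ≥ 3.
module Submission where

open import Defs
open import Data.Nat
open import Data.Nat.Properties
open import Data.Nat.Induction using (<-rec; <-wellFounded)
open import Data.Nat.DivMod using ([m+kn]%n≡m%n; +-distrib-/-∣ʳ; *-/-assoc)
open import Data.Nat.Divisibility using (divides; ∣n⇒∣m*n)
open import Data.Nat.Tactic.RingSolver using (solve-∀)
open import Data.Product using (_×_; _,_; proj₁; proj₂)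
open import Data.Unit using (tt)
open import Data.Empty using (⊥-elim)
open import Relation.Nullary using (yes; no)
open import Relation.Binary.PropositionalEquality
import Induction.WellFounded as WF

guard-cong : ∀ n {f f′ : {m : ℕ} → m < n → ℕ} → (∀ {m} (m<n : m < n) → f m<n ≡ f′ m<n) →
             ∀ m → guard n f m ≡ guard n f′ m
guard-cong n f≗f′ m with m <? n
... | yes m<n = f≗f′ m<n
... | no  _   = refl

guard-< : ∀ n (f : ℕ → ℕ) {m} → m < n → guard n (λ {k} _ → f k) m ≡ f m
guard-< n f {m} m<n with m <? n
... | yes _   = refl
... | no  m≮n = ⊥-elim (m≮n m<n)

minFrom1-cong : ∀ {f f′ : ℕ → ℕ} m → (∀ i → 1 ≤ i → i ≤ suc m → f i ≡ f′ i) →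
                minFrom1 f m ≡ minFrom1 f′ m
minFrom1-cong zero    f≗f′ = f≗f′ 1 ≤-refl ≤-refl
minFrom1-cong (suc m) f≗f′ = cong₂ _⊓_ (f≗f′ (2 + m) (s≤s z≤n) ≤-refl)
  (minFrom1-cong m λ i 1≤i i≤1+m → f≗f′ i 1≤i (m≤n⇒m≤1+n i≤1+m))

gStep-cong : ∀ n {f f′ : {m : ℕ} → m < n → ℕ} → (∀ {m} (m<n : m < n) → f m<n ≡ f′ m<n) →
             gStep n f ≡ gStep n f′
gStep-cong 0 _ = refl
gStep-cong 1 _ = refl
gStep-cong 2 _ = refl
gStep-cong 3 _ = refl
gStep-cong 4 _ = refl
gStep-cong 5 _ = refl
gStep-cong n@(suc (suc (suc (suc (suc (suc k)))))) f≗f′ =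
  cong ((5 + k) +_) (minFrom1-cong (3 + k) λ i _ _ →
    cong₂ _+_ (guard-cong n f≗f′ i) (guard-cong n f≗f′ ((5 + k) ∸ i)))

xStep-cong : ∀ n {f f′ : {m : ℕ} → m < n → ℕ} → (∀ {m} (m<n : m < n) → f m<n ≡ f′ m<n) →
             xStep n f ≡ xStep n f′
xStep-cong 0 _ = refl
xStep-cong 1 _ = refl
xStep-cong 2 _ = refl
xStep-cong 3 _ = refl
xStep-cong 4 _ = refl
xStep-cong 5 _ = refl
xStep-cong n@(suc (suc (suc (suc (suc (suc k)))))) f≗f′ with n % 4
... | 1 = cong ((n ∸ 1) +_)
  (cong₂ _+_ (guard-cong n f≗f′ ((n + 1) / 2)) (guard-cong n f≗f′ ((n ∸ 3) / 2)))
... | 3 = cong ((n ∸ 1) +_) (cong (2 *_) (guard-cong n f≗f′ ((n ∸ 1) / 2)))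
... | 0 = cong ((n ∸ 1) +_)
  (cong₂ _+_ (guard-cong n f≗f′ (n / 2)) (guard-cong n f≗f′ ((n ∸ 2) / 2)))
... | 2 = cong ((n ∸ 1) +_)
  (cong₂ _+_ (guard-cong n f≗f′ (n / 2)) (guard-cong n f≗f′ ((n ∸ 2) / 2)))
... | suc (suc (suc (suc _))) = cong ((n ∸ 1) +_)
  (cong₂ _+_ (guard-cong n f≗f′ (n / 2)) (guard-cong n f≗f′ ((n ∸ 2) / 2)))

g-unfold : ∀ n → g n ≡ gStep n (λ {m} _ → g m)
g-unfold n = WF.FixPoint.unfold-wfRec <-wellFounded (λ _ → ℕ) gStep gStep-cong {n}

x-unfold : ∀ n → x n ≡ xStep n (λ {m} _ → x m)
x-unfold n = WF.FixPoint.unfold-wfRec <-wellFounded (λ _ → ℕ) xStep xStep-cong {n}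

-- The parts n₁ = hi n ≥ n₂ = lo n of n - 1 used by the recurrence for x, for n ≥ 1.
hi : ℕ → ℕ
hi 0 = 0
hi 1 = 0
hi 2 = 1
hi 3 = 1
hi 4 = 2
hi 5 = 3
hi (suc (suc (suc (suc (suc (suc n)))))) = 2 + hi (suc (suc n))

lo : ℕ → ℕ
lo 0 = 0
lo 1 = 0
lo 2 = 0
lo 3 = 1
lo 4 = 1
lo 5 = 1
lo (suc (suc (suc (suc (suc (suc n)))))) = 2 + lo (suc (suc n))

hi+lo : ∀ c → hi (suc c) + lo (suc c) ≡ c
hi+lo 0 = refl
hi+lo 1 = refl
hi+lo 2 = refl
hi+lo 3 = refl
hi+lo 4 = refl
hi+lo (suc (suc (suc (suc (suc c))))) = begin
  (2 + hi (2 + c)) + (2 + lo (2 + c)) ≡⟨ shuffle (hi (2 + c)) (lo (2 + c)) ⟩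
  4 + (hi (2 + c) + lo (2 + c))       ≡⟨ cong (4 +_) (hi+lo (suc c)) ⟩
  5 + c                                ∎
  where
  open ≡-Reasoning
  shuffle : ∀ h l → (2 + h) + (2 + l) ≡ 4 + (h + l)
  shuffle = solve-∀

hi-< : ∀ c → hi (suc c) < suc c
hi-< c = s≤s (subst (hi (suc c) ≤_) (hi+lo c) (m≤m+n _ _))

lo-< : ∀ c → lo (suc c) < suc c
lo-< c = s≤s (subst (lo (suc c) ≤_) (hi+lo c) (m≤n+m _ _))

quasi-periodic : (f : ℕ → ℕ) → (∀ n → f (6 + n) ≡ 2 + f (2 + n)) →
                 ∀ n q → f (2 + n + q * 4) ≡ f (2 + n) + q * 2
quasi-periodic f f-step n zero    = trans (cong f (+-identityʳ (2 + n))) (sym (+-identityʳ _))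
quasi-periodic f f-step n (suc q) = begin
  f (2 + n + (4 + q * 4)) ≡⟨ cong f (shift n (q * 4)) ⟩
  f (6 + (n + q * 4))     ≡⟨ f-step (n + q * 4) ⟩
  2 + f (2 + n + q * 4)   ≡⟨ cong (2 +_) (quasi-periodic f f-step n q) ⟩
  2 + (f (2 + n) + q * 2) ≡⟨ inward (f (2 + n)) (q * 2) ⟩
  f (2 + n) + (2 + q * 2) ∎
  where
  open ≡-Reasoning
  shift : ∀ n m → 2 + n + (4 + m) ≡ 6 + (n + m)
  shift = solve-∀
  inward : ∀ h m → 2 + (h + m) ≡ h + (2 + m)
  inward = solve-∀

hi-periodic : ∀ n q → hi (2 + n + q * 4) ≡ hi (2 + n) + q * 2
hi-periodic = quasi-periodic hi (λ _ → refl)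

lo-periodic : ∀ n q → lo (2 + n + q * 4) ≡ lo (2 + n) + q * 2
lo-periodic = quasi-periodic lo (λ _ → refl)

data Class : ℕ → Set where
  6+4q : ∀ q → Class (6 + q * 4)
  7+4q : ∀ q → Class (7 + q * 4)
  8+4q : ∀ q → Class (8 + q * 4)
  9+4q : ∀ q → Class (9 + q * 4)

class : ∀ k → Class (6 + k)
class 0 = 6+4q 0
class 1 = 7+4q 0
class 2 = 8+4q 0
class 3 = 9+4q 0
class (suc (suc (suc (suc k)))) with class k
... | 6+4q q = 6+4q (suc q)
... | 7+4q q = 7+4q (suc q)
... | 8+4q q = 8+4q (suc q)
... | 9+4q q = 9+4q (suc q)

[r+q*4]/2≡r/2+q*2 : ∀ r q → (r + q * 4) / 2 ≡ r / 2 + q * 2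
[r+q*4]/2≡r/2+q*2 r q =
  trans (+-distrib-/-∣ʳ r (∣n⇒∣m*n q 2∣4)) (cong (r / 2 +_) (*-/-assoc q 2∣4))
  where 2∣4 = divides 2 refl

guard-x : ∀ {n m m′} → m ≡ m′ → m′ < n → guard n (λ {k} _ → x k) m ≡ x m′
guard-x {n} refl m′<n = guard-< n x m′<n

xStep-split : ∀ {n} → Class n → xStep n (λ {m} _ → x m) ≡ (n ∸ 1) + (x (hi n) + x (lo n))
xStep-split (6+4q q) with (6 + q * 4) % 4 | [m+kn]%n≡m%n 6 q 4
... | .2 | refl = cong ((5 + q * 4) +_) (cong₂ _+_
  (guard-x (trans ([r+q*4]/2≡r/2+q*2 6 q) (sym (hi-periodic 4 q))) (hi-< _))
  (guard-x (trans ([r+q*4]/2≡r/2+q*2 4 q) (sym (lo-periodic 4 q))) (lo-< _)))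
xStep-split (7+4q q) with (7 + q * 4) % 4 | [m+kn]%n≡m%n 7 q 4
... | .3 | refl = cong ((6 + q * 4) +_) (trans (cong (X +_) (+-identityʳ X)) (cong₂ _+_
  (guard-x (trans ([r+q*4]/2≡r/2+q*2 6 q) (sym (hi-periodic 5 q))) (hi-< _))
  (guard-x (trans ([r+q*4]/2≡r/2+q*2 6 q) (sym (lo-periodic 5 q))) (lo-< _))))
  where X = guard (7 + q * 4) (λ {m} _ → x m) ((6 + q * 4) / 2)
xStep-split (8+4q q) with (8 + q * 4) % 4 | [m+kn]%n≡m%n 8 q 4
... | .0 | refl = cong ((7 + q * 4) +_) (cong₂ _+_
  (guard-x (trans ([r+q*4]/2≡r/2+q*2 8 q) (sym (hi-periodic 6 q))) (hi-< _))
  (guard-x (trans ([r+q*4]/2≡r/2+q*2 6 q) (sym (lo-periodic 6 q))) (lo-< _)))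
xStep-split (9+4q q) with (9 + q * 4) % 4 | [m+kn]%n≡m%n 9 q 4
... | .1 | refl = cong ((8 + q * 4) +_) (cong₂ _+_
  (guard-x (trans (cong (_/ 2) (+-comm (9 + q * 4) 1))
                  (trans ([r+q*4]/2≡r/2+q*2 10 q) (sym (hi-periodic 7 q)))) (hi-< _))
  (guard-x (trans ([r+q*4]/2≡r/2+q*2 6 q) (sym (lo-periodic 7 q))) (lo-< _)))

x-split : ∀ n → n ≢ 5 → x n ≡ (n ∸ 1) + (x (hi n) + x (lo n))
x-split 0 _ = refl
x-split 1 _ = refl
x-split 2 _ = refl
x-split 3 _ = refl
x-split 4 _ = refl
x-split 5 5≢5 = ⊥-elim (5≢5 refl)
x-split (suc (suc (suc (suc (suc (suc k)))))) _ = trans (x-unfold (6 + k)) (xStep-split (class k))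

x-≤-split : ∀ n → x n ≤ (n ∸ 1) + (x (hi n) + x (lo n))
x-≤-split n with n ≟ 5
... | yes refl = ≤ᵇ⇒≤ _ _ tt
... | no  n≢5  = ≤-reflexive (x-split n n≢5)

data IsSplit (n : ℕ) : ℕ → ℕ → Set where
  as-is   : IsSplit n (hi n) (lo n)
  swapped : IsSplit n (lo n) (hi n)

IsSplit-symmetric : (f : ℕ → ℕ → ℕ) → (∀ p q → f p q ≡ f q p) →
                    ∀ {n p q} → IsSplit n p q → f (hi n) (lo n) ≡ f p q
IsSplit-symmetric f f-comm as-is   = refl
IsSplit-symmetric f f-comm swapped = f-comm _ _

IsSplit-sum : ∀ {c p q} → IsSplit (suc c) p q → p + q ≡ c
IsSplit-sum {c} s = trans (sym (IsSplit-symmetric _+_ +-comm s)) (hi+lo c)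

IsSplit-x : ∀ {n p q} → IsSplit n p q → x (hi n) + x (lo n) ≡ x p + x q
IsSplit-x = IsSplit-symmetric (λ p q → x p + x q) (λ p q → +-comm (x p) (x q))

IsSplit-< : ∀ {c p q} → IsSplit (suc c) p q → p < suc c × q < suc c
IsSplit-< {c} as-is   = hi-< c , lo-< c
IsSplit-< {c} swapped = lo-< c , hi-< c

IsSplit-+4 : ∀ {n p q} → IsSplit (2 + n) p q → IsSplit (6 + n) (2 + p) (2 + q)
IsSplit-+4 as-is   = as-is
IsSplit-+4 swapped = swapped

IsSplit-6+-≥2 : ∀ {n p q} → IsSplit (6 + n) p q → 2 ≤ p × 2 ≤ q
IsSplit-6+-≥2 as-is   = s≤s (s≤s z≤n) , s≤s (s≤s z≤n)
IsSplit-6+-≥2 swapped = s≤s (s≤s z≤n) , s≤s (s≤s z≤n)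

IsSplit-10+-≥3 : ∀ {n p q} → IsSplit (10 + n) p q → 3 ≤ p × 3 ≤ q
IsSplit-10+-≥3 as-is   = s≤s (s≤s (s≤s z≤n)) , s≤s (s≤s (s≤s z≤n))
IsSplit-10+-≥3 swapped = s≤s (s≤s (s≤s z≤n)) , s≤s (s≤s (s≤s z≤n))

x-≤-IsSplit : ∀ {n p q} → IsSplit n p q → x n ≤ (n ∸ 1) + (x p + x q)
x-≤-IsSplit {n} s = subst (λ y → x n ≤ (n ∸ 1) + y) (IsSplit-x s) (x-≤-split n)

x-IsSplit : ∀ {c p q} → suc c ≢ 5 → IsSplit (suc c) p q → x (suc c) ≡ (p + q) + (x p + x q)
x-IsSplit {c} ≢5 s = trans (x-split (suc c) ≢5) (cong₂ _+_ (sym (IsSplit-sum s)) (IsSplit-x s))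

-- The join inequality for a ≤ 1

-- x (a + b + 1) is at most the arc count of O_a and O_b joined through a new vertex.
-- With the junk value x 0 = 0, Join 0 b reads x (b + 1) ≤ b + x b.
Join : ℕ → ℕ → Set
Join a b = x (suc (a + b)) ≤ (a + b) + (x a + x b)

Join-comm : ∀ a b → Join a b → Join b a
Join-comm a b = subst₂ (λ s y → x (suc s) ≤ s + y) (+-comm a b) (+-comm (x a) (x b))

record Grows (m n k : ℕ) : Set where
  constructor grows
  field
    {p q} : ℕ
    old   : IsSplit m p q
    new   : IsSplit n (k + p) q

Grows-+4 : ∀ {m n k} → Grows (2 + m) (2 + n) k → Grows (6 + m) (6 + n) k
Grows-+4 {n = n} {k} (grows {p} {q} old new) =
  grows (IsSplit-+4 old) (subst (λ r → IsSplit (6 + n) r (2 + q)) (k+[2+p] k p) (IsSplit-+4 new))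
  where
  k+[2+p] : ∀ k p → 2 + (k + p) ≡ k + (2 + p)
  k+[2+p] = solve-∀

grows-by-1 : ∀ c → Grows (1 + c) (2 + c) 1
grows-by-1 0 = grows as-is   as-is
grows-by-1 1 = grows swapped as-is
grows-by-1 2 = grows as-is   as-is
grows-by-1 3 = grows as-is   as-is
grows-by-1 4 = grows swapped swapped
grows-by-1 (suc (suc (suc (suc (suc c))))) = Grows-+4 (grows-by-1 (suc c))

grows-by-2 : ∀ c → Grows (2 + c) (4 + c) 2
grows-by-2 0 = grows swapped as-is
grows-by-2 1 = grows as-is   as-is
grows-by-2 2 = grows swapped as-is
grows-by-2 3 = grows swapped as-is
grows-by-2 (suc (suc (suc (suc c)))) = Grows-+4 (grows-by-2 c)

join-0 : ∀ b → Join 0 b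
join-0 = <-rec (Join 0) step
  where
  step : ∀ c → (∀ {m} → m < c → Join 0 m) → Join 0 c
  step 0 _ = ≤ᵇ⇒≤ _ _ tt
  step 1 _ = ≤ᵇ⇒≤ _ _ tt
  step 2 _ = ≤ᵇ⇒≤ _ _ tt
  step 3 _ = ≤ᵇ⇒≤ _ _ tt
  step 4 _ = ≤ᵇ⇒≤ _ _ tt
  step 5 _ = ≤ᵇ⇒≤ _ _ tt
  step c@(suc c₀@(suc (suc (suc (suc (suc _)))))) ih with grows-by-1 c₀
  ... | grows {p} {q} old new = begin
    x (suc c)                   ≤⟨ x-≤-IsSplit new ⟩
    c + (x (suc p) + x q)       ≤⟨ +-monoʳ-≤ c (+-monoˡ-≤ (x q) (ih (proj₁ (IsSplit-< old)))) ⟩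
    c + ((p + x p) + x q)       ≡⟨ cong (c +_) (+-assoc p (x p) (x q)) ⟩
    c + (p + (x p + x q))       ≤⟨ +-monoʳ-≤ c (+-monoˡ-≤ (x p + x q) (m≤m+n p q)) ⟩
    c + ((p + q) + (x p + x q)) ≡⟨ cong (c +_) (sym (x-IsSplit (λ ()) old)) ⟩
    c + x c                     ∎
    where open ≤-Reasoning

x-2+-≤-step : ∀ c → (∀ {m} → m < 6 + c → Join 1 m) → x (8 + c) ≤ (6 + c) + x (6 + c)
x-2+-≤-step c ih with grows-by-2 (4 + c)
... | grows {p} {q} old new = begin
  x (8 + c)                         ≤⟨ x-≤-IsSplit new ⟩
  (7 + c) + (x (2 + p) + x q)       ≤⟨ +-monoʳ-≤ (7 + c) (+-monoˡ-≤ (x q) join-1-p) ⟩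
  (7 + c) + (((1 + p) + x p) + x q) ≡⟨ shuffle (6 + c) p (x p) (x q) ⟩
  (6 + c) + ((2 + p) + (x p + x q)) ≤⟨ +-monoʳ-≤ (6 + c) (+-monoˡ-≤ (x p + x q) 2+p≤q+p) ⟩
  (6 + c) + ((q + p) + (x p + x q)) ≡⟨ cong (λ s → (6 + c) + (s + (x p + x q))) (+-comm q p) ⟩
  (6 + c) + ((p + q) + (x p + x q)) ≡⟨ cong ((6 + c) +_) (sym (x-IsSplit (λ ()) old)) ⟩
  (6 + c) + x (6 + c)               ∎
  where
  open ≤-Reasoning
  join-1-p : Join 1 p
  join-1-p = ih (proj₁ (IsSplit-< old))
  2+p≤q+p : 2 + p ≤ q + p
  2+p≤q+p = +-monoˡ-≤ p (proj₂ (IsSplit-6+-≥2 old))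
  shuffle : ∀ s p a b → (1 + s) + (((1 + p) + a) + b) ≡ s + ((2 + p) + (a + b))
  shuffle = solve-∀

join-1 : ∀ b → Join 1 b
join-1 = <-rec (Join 1) step
  where
  step : ∀ c → (∀ {m} → m < c → Join 1 m) → Join 1 c
  step 0 _ = ≤ᵇ⇒≤ _ _ tt
  step 1 _ = ≤ᵇ⇒≤ _ _ tt
  step 2 _ = ≤ᵇ⇒≤ _ _ tt
  step 3 _ = ≤ᵇ⇒≤ _ _ tt
  step 4 _ = ≤ᵇ⇒≤ _ _ tt
  step 5 _ = ≤ᵇ⇒≤ _ _ tt
  step (suc (suc (suc (suc (suc (suc c)))))) ih = m≤n⇒m≤1+n (x-2+-≤-step c ih)

x-2+-≤ : ∀ c → 3 ≤ c → x (2 + c) ≤ c + x c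
x-2+-≤ 0 ()
x-2+-≤ 1 (s≤s ())
x-2+-≤ 2 (s≤s (s≤s ()))
x-2+-≤ 3 _ = ≤ᵇ⇒≤ _ _ tt
x-2+-≤ 4 _ = ≤ᵇ⇒≤ _ _ tt
x-2+-≤ 5 _ = ≤ᵇ⇒≤ _ _ tt
x-2+-≤ (suc (suc (suc (suc (suc (suc c)))))) _ = x-2+-≤-step c (λ {m} _ → join-1 m)

-- The join inequality for a, b ≥ 2

record Combined (a b : ℕ) : Set where
  constructor combined
  field
    {a₁ a₂ b₁ b₂} : ℕ
    split-a : IsSplit a a₁ a₂
    split-b : IsSplit b b₁ b₂
    hi-join : hi (suc (a + b)) ≡ suc (a₁ + b₁)
    lo-join : lo (suc (a + b)) ≡ suc (a₂ + b₂)

Combined-comm : ∀ {a b} → Combined a b → Combined b a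
Combined-comm {a} {b} (combined {a₁} {a₂} {b₁} {b₂} sa sb h l) = combined sb sa
  (trans (cong (λ s → hi (suc s)) (+-comm b a)) (trans h (cong suc (+-comm a₁ b₁))))
  (trans (cong (λ s → lo (suc s)) (+-comm b a)) (trans l (cong suc (+-comm a₂ b₂))))

Combined-+4 : ∀ {a b} → Combined (2 + a) b → Combined (6 + a) b
Combined-+4 (combined sa sb h l) = combined (IsSplit-+4 sa) sb (cong (2 +_) h) (cong (2 +_) l)

combine : ∀ a b → Combined (2 + a) (2 + b)
combine (suc (suc (suc (suc a)))) b = Combined-+4 (combine a b)
combine a (suc (suc (suc (suc b)))) = Combined-comm (Combined-+4 (Combined-comm (combine a b)))
combine 0 0 = combined as-is   as-is   refl refl
combine 0 1 = combined as-is   as-is   refl refl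
combine 0 2 = combined as-is   swapped refl refl
combine 0 3 = combined swapped as-is   refl refl
combine 1 0 = combined as-is   as-is   refl refl
combine 1 1 = combined as-is   as-is   refl refl
combine 1 2 = combined as-is   as-is   refl refl
combine 1 3 = combined as-is   as-is   refl refl
combine 2 0 = combined as-is   swapped refl refl
combine 2 1 = combined as-is   as-is   refl refl
combine 2 2 = combined as-is   as-is   refl refl
combine 2 3 = combined swapped as-is   refl refl
combine 3 0 = combined as-is   swapped refl refl
combine 3 1 = combined as-is   as-is   refl refl
combine 3 2 = combined as-is   swapped refl refl
combine 3 3 = combined as-is   swapped refl refl

-- e₁ + e₂ is how far x (suc a) falls short of its split (nonzero only for a = 5).
join-by-parts : ∀ {a b} (C : Combined (suc a) (suc b)) (e₁ e₂ : ℕ) → let open Combined C in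
  (e₁ + e₂) + x (suc a) ≡ (a₁ + a₂) + (x a₁ + x a₂) →
  x (suc b) ≡ (b₁ + b₂) + (x b₁ + x b₂) →
  e₁ + x (suc (a₁ + b₁)) ≤ (a₁ + b₁) + (x a₁ + x b₁) →
  e₂ + x (suc (a₂ + b₂)) ≤ (a₂ + b₂) + (x a₂ + x b₂) →
  Join (suc a) (suc b)
join-by-parts {a} {b} (combined {a₁} {a₂} {b₁} {b₂} _ _ h l) e₁ e₂ xa xb bound₁ bound₂ =
  +-cancelˡ-≤ (e₁ + e₂) _ _ (begin
    (e₁ + e₂) + x (suc s)
      ≤⟨ +-monoʳ-≤ (e₁ + e₂) x-≤-parts ⟩
    (e₁ + e₂) + (s + (x (suc (a₁ + b₁)) + x (suc (a₂ + b₂))))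
      ≡⟨ shuffle₁ e₁ e₂ s (x (suc (a₁ + b₁))) (x (suc (a₂ + b₂))) ⟩
    s + ((e₁ + x (suc (a₁ + b₁))) + (e₂ + x (suc (a₂ + b₂))))
      ≤⟨ +-monoʳ-≤ s (+-mono-≤ bound₁ bound₂) ⟩
    s + (((a₁ + b₁) + (x a₁ + x b₁)) + ((a₂ + b₂) + (x a₂ + x b₂)))
      ≡⟨ cong (s +_) (shuffle₂ a₁ a₂ b₁ b₂ (x a₁) (x a₂) (x b₁) (x b₂)) ⟩
    s + (((a₁ + a₂) + (x a₁ + x a₂)) + ((b₁ + b₂) + (x b₁ + x b₂)))
      ≡⟨ cong (s +_) (cong₂ _+_ (sym xa) (sym xb)) ⟩
    s + (((e₁ + e₂) + x (suc a)) + x (suc b))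
      ≡⟨ shuffle₃ s (e₁ + e₂) (x (suc a)) (x (suc b)) ⟩
    (e₁ + e₂) + (s + (x (suc a) + x (suc b)))
      ∎)
  where
  open ≤-Reasoning
  s = suc a + suc b
  x-≤-parts : x (suc s) ≤ s + (x (suc (a₁ + b₁)) + x (suc (a₂ + b₂)))
  x-≤-parts = subst₂ (λ h′ l′ → x (suc s) ≤ s + (x h′ + x l′)) h l (x-≤-split (suc s))
  shuffle₁ : ∀ e₁ e₂ s y z → (e₁ + e₂) + (s + (y + z)) ≡ s + ((e₁ + y) + (e₂ + z))
  shuffle₁ = solve-∀
  shuffle₂ : ∀ a₁ a₂ b₁ b₂ y₁ y₂ z₁ z₂ → ((a₁ + b₁) + (y₁ + z₁)) + ((a₂ + b₂) + (y₂ + z₂))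
                                        ≡ ((a₁ + a₂) + (y₁ + y₂)) + ((b₁ + b₂) + (z₁ + z₂))
  shuffle₂ = solve-∀
  shuffle₃ : ∀ s e y z → s + ((e + y) + z) ≡ e + (s + (y + z))
  shuffle₃ = solve-∀

JoinsBelow : ℕ → Set
JoinsBelow s = ∀ a b → a + b < s → Join a b

join-generic : ∀ a b → 2 + a ≢ 5 → 2 + b ≢ 5 → JoinsBelow ((2 + a) + (2 + b)) →
               Join (2 + a) (2 + b)
join-generic a b a≢5 b≢5 ih = join-by-parts C 0 0
  (x-IsSplit a≢5 split-a) (x-IsSplit b≢5 split-b)
  (ih a₁ b₁ (+-mono-< (proj₁ (IsSplit-< split-a)) (proj₁ (IsSplit-< split-b))))
  (ih a₂ b₂ (+-mono-< (proj₂ (IsSplit-< split-a)) (proj₂ (IsSplit-< split-b))))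
  where
  C = combine a b
  open Combined C

-- The part joined to the 1 of the split (3, 1) of 5 supplies the missing unit, by x-2+-≤.
join-5 : ∀ b → JoinsBelow (5 + (2 + b)) → Join 5 (2 + b)
join-5 0 _ = ≤ᵇ⇒≤ _ _ tt
join-5 1 _ = ≤ᵇ⇒≤ _ _ tt
join-5 2 _ = ≤ᵇ⇒≤ _ _ tt
join-5 3 _ = ≤ᵇ⇒≤ _ _ tt
join-5 4 _ = ≤ᵇ⇒≤ _ _ tt
join-5 5 _ = ≤ᵇ⇒≤ _ _ tt
join-5 6 _ = ≤ᵇ⇒≤ _ _ tt
join-5 7 _ = ≤ᵇ⇒≤ _ _ tt
join-5 (suc (suc (suc (suc (suc (suc (suc (suc n)))))))) ih with combine 3 (8 + n)
... | C@(combined as-is sb _ _) = join-by-parts C 0 1 refl (x-IsSplit (λ ()) sb)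
  (ih 3 _ (+-mono-< (hi-< 4) (proj₁ (IsSplit-< sb))))
  (s≤s (x-2+-≤ _ (proj₂ (IsSplit-10+-≥3 sb))))
... | C@(combined swapped sb _ _) = join-by-parts C 1 0 refl (x-IsSplit (λ ()) sb)
  (s≤s (x-2+-≤ _ (proj₁ (IsSplit-10+-≥3 sb))))
  (ih 3 _ (+-mono-< (hi-< 4) (proj₂ (IsSplit-< sb))))

join-step : ∀ a b → JoinsBelow (a + b) → Join a b
join-step 0 b _ = join-0 b
join-step 1 b _ = join-1 b
join-step (suc (suc a)) 0 _ = Join-comm 0 (2 + a) (join-0 (2 + a))
join-step (suc (suc a)) 1 _ = Join-comm 1 (2 + a) (join-1 (2 + a))
join-step (suc (suc a)) (suc (suc b)) ih with 2 + a ≟ 5 | 2 + b ≟ 5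
... | yes refl | _        = join-5 b ih
... | no _     | yes refl =
  Join-comm 5 (2 + a) (join-5 a λ c d c+d< → ih c d (subst (c + d <_) (+-comm 5 (2 + a)) c+d<))
... | no a≢5   | no b≢5   = join-generic a b a≢5 b≢5 ih

x-join-≤ : ∀ a b → Join a b
x-join-≤ a b = <-rec (λ s → ∀ a b → a + b ≡ s → Join a b)
  (λ s rec a b a+b≡s → join-step a b λ c d c+d< → rec (subst (c + d <_) a+b≡s c+d<) c d refl)
  (a + b) a b refl

-- The minimum in the recurrence for g

minFrom1-≤ : ∀ f m {i} → 1 ≤ i → i ≤ suc m → minFrom1 f m ≤ f i
minFrom1-≤ f zero    (s≤s z≤n) (s≤s z≤n) = ≤-refl
minFrom1-≤ f (suc m) {i} 1≤i i≤2+m with i ≟ 2 + m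
... | yes refl  = m⊓n≤m (f (2 + m)) (minFrom1 f m)
... | no  i≢2+m = ≤-trans (m⊓n≤n (f (2 + m)) (minFrom1 f m))
                          (minFrom1-≤ f m 1≤i (≤-pred (≤∧≢⇒< i≤2+m i≢2+m)))

minFrom1-greatest : ∀ f m {v} → (∀ i → 1 ≤ i → i ≤ suc m → v ≤ f i) → v ≤ minFrom1 f m
minFrom1-greatest f zero    v≤f = v≤f 1 ≤-refl ≤-refl
minFrom1-greatest f (suc m) v≤f = ⊓-glb (v≤f (2 + m) (s≤s z≤n) ≤-refl)
  (minFrom1-greatest f m λ i 1≤i i≤1+m → v≤f i 1≤i (m≤n⇒m≤1+n i≤1+m))

minFrom1-attained : ∀ f m {v i} → (∀ i → 1 ≤ i → i ≤ suc m → v ≤ f i) →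
                    1 ≤ i → i ≤ suc m → f i ≡ v → minFrom1 f m ≡ v
minFrom1-attained f m v≤f 1≤i i≤1+m fi≡v =
  ≤-antisym (≤-trans (minFrom1-≤ f m 1≤i i≤1+m) (≤-reflexive fi≡v)) (minFrom1-greatest f m v≤f)

x-min-split : ∀ k → minFrom1 (λ i → x i + x ((5 + k) ∸ i)) (3 + k) ≡ x (hi (6 + k)) + x (lo (6 + k))
x-min-split k = minFrom1-attained _ (3 + k) split-≤ (s≤s z≤n) hi≤4+k
  (cong (λ j → x (hi (6 + k)) + x j) 5+k∸hi≡lo)
  where
  split-≤ : ∀ i → 1 ≤ i → i ≤ 4 + k → x (hi (6 + k)) + x (lo (6 + k)) ≤ x i + x ((5 + k) ∸ i)
  split-≤ i _ i≤4+k = +-cancelˡ-≤ (5 + k) _ _ (begin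
    (5 + k) + (x (hi (6 + k)) + x (lo (6 + k))) ≡⟨ sym (x-split (6 + k) (λ ())) ⟩
    x (6 + k)                                   ≡⟨ cong (λ s → x (suc s)) (sym i+j≡5+k) ⟩
    x (suc (i + j))                             ≤⟨ x-join-≤ i j ⟩
    (i + j) + (x i + x j)                       ≡⟨ cong (_+ (x i + x j)) i+j≡5+k ⟩
    (5 + k) + (x i + x j)                       ∎)
    where
    open ≤-Reasoning
    j = (5 + k) ∸ i
    i+j≡5+k : i + j ≡ 5 + k
    i+j≡5+k = m+[n∸m]≡n (m≤n⇒m≤1+n i≤4+k)
  5+k∸hi≡lo : (5 + k) ∸ hi (6 + k) ≡ lo (6 + k)
  5+k∸hi≡lo = trans (cong (_∸ hi (6 + k)) (sym (hi+lo (5 + k)))) (m+n∸m≡n (hi (6 + k)) (lo (6 + k)))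
  hi≤4+k : hi (6 + k) ≤ 4 + k
  hi≤4+k = ≤-pred (subst (hi (6 + k) <_) (hi+lo (5 + k)) (m<m+n _ (s≤s z≤n)))

g≡x-from-6 : ∀ k → (∀ {m} → m < 6 + k → 1 ≤ m → g m ≡ x m) → g (6 + k) ≡ x (6 + k)
g≡x-from-6 k ih = begin
  g (6 + k)                                   ≡⟨ g-unfold (6 + k) ⟩
  (5 + k) + minFrom1 (pairs G) (3 + k)        ≡⟨ cong ((5 + k) +_) (minFrom1-cong (3 + k) G≗x) ⟩
  (5 + k) + minFrom1 (pairs x) (3 + k)        ≡⟨ cong ((5 + k) +_) (x-min-split k) ⟩
  (5 + k) + (x (hi (6 + k)) + x (lo (6 + k))) ≡⟨ sym (x-split (6 + k) (λ ())) ⟩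
  x (6 + k)                                   ∎
  where
  open ≡-Reasoning
  pairs : (ℕ → ℕ) → ℕ → ℕ
  pairs f i = f i + f ((5 + k) ∸ i)
  G : ℕ → ℕ
  G = guard (6 + k) (λ {m} _ → g m)
  G≡x : ∀ {m} → m < 6 + k → 1 ≤ m → G m ≡ x m
  G≡x m<6+k 1≤m = trans (guard-< (6 + k) g m<6+k) (ih m<6+k 1≤m)
  G≗x : ∀ i → 1 ≤ i → i ≤ 4 + k → pairs G i ≡ pairs x i
  G≗x i 1≤i i≤4+k = cong₂ _+_ (G≡x (m≤n⇒m≤1+n (s≤s i≤4+k)) 1≤i)
                              (G≡x (s≤s (m∸n≤m (5 + k) i)) (m<n⇒0<n∸m (s≤s i≤4+k)))

theorem7 : (n : ℕ) → 1 ≤ n → g n ≡ x n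
theorem7 = <-rec (λ n → 1 ≤ n → g n ≡ x n) step
  where
  step : ∀ n → (∀ {m} → m < n → 1 ≤ m → g m ≡ x m) → 1 ≤ n → g n ≡ x n
  step 1 _ _ = refl
  step 2 _ _ = refl
  step 3 _ _ = refl
  step 4 _ _ = refl
  step 5 _ _ = refl
  step (suc (suc (suc (suc (suc (suc k)))))) ih _ = g≡x-from-6 k ih
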